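{- Let $\mathbf{s}_0$ be a binary sequence of even period $N$, and let $\mathbf{s}_1$ be either $L^{N/2}(\mathbf{s}_0)$ or $L^{N/2}(\overline{\mathbf{s}}_0)$. Define the quaternary sequence $\mathbf{u}$ of period $N$ by $u(t)=\phi^{ -1}(s_0(t),s_1(t))$. Then $R_{\mathbf{u}}(\tau)=R_{\mathbf{s}_0}(\tau)$ for all $0\le\tau<N$. Moreover \[N_0(\mathbf{u})=|\overline{D}_{\mathbf{s}_0}\cap\overline{D}_{\mathbf{s}_1}|,\quad N_1(\mathbf{u})=|\overline{D}_{\mathbf{s}_0}\cap D_{\mathbf{s}_1}|,\quad N_2(\mathbf{u})=|D_{\mathbf{s}_0}\cap D_{\mathbf{s}_1}|,\quad N_3(\mathbf{u})=|D_{\mathbf{s}_0}\cap \overline{D}_{\mathbf{s}_1}|.\]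
   Context: For a sequence $\mathbf{s}=(s(t))$ of period $N$ over $\mathbb{Z}_m$, $N_k(\mathbf{s})=|\{0\le t<N: s(t)=k\}|$ and $R_{\mathbf{s}}(\tau)=\sum_{t=0}^{N-1}\omega^{s(t)-s(t+\tau)}$ with $\omega=e^{2\pi\sqrt{ -1}/m}$ and indices modulo $N$ (so $\omega=-1$ for binary and $\omega=\sqrt{ -1}$ for quaternary sequences). $L^{\tau}$ is the left cyclic shift: $L^{\tau}(\mathbf{s})=(s(t+\tau))_t$. $\overline{\mathbf{s}}$ is the complement of a binary sequence ($\overline{s}(t)=1-s(t)$). For a binary sequence $\mathbf{s}$, $D_{\mathbf{s}}=\{t\in\mathbb{Z}_N: s(t)=1\}$ is its support and $\overline{D}_{\mathbf{s}}=\mathbb{Z}_N\setminus D_{\mathbf{s}}$. $\phi:\mathbb{Z}_4\to\mathbb{Z}_2\times\mathbb{Z}_2$ is the Gray map $\phi(0)=(0,0),\phi(1)=(0,1),\phi(2)=(1,1),\phi(3)=(1,0)$. -}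

module Defs where

open import Data.Nat as ℕ using (ℕ; zero; suc; NonZero; _∸_)
open import Data.Nat.DivMod using (_mod_; _%_)
open import Data.Integer as ℤ using (ℤ; +_; -_; 0ℤ; 1ℤ)
open import Data.Fin using (Fin; toℕ; zero; suc)
open import Data.Fin.Subset using (Subset)
open import Data.List using (List; map; foldr)
open import Data.List as L using (allFin)
open import Data.Vec using (tabulate)
open import Data.Bool using (Bool)
open import Data.Product using (_×_; _,_)
open import Relation.Nullary using (does)
open import Data.Fin using (_≟_)

-- A sequence of period N over ℤ_m, given by one period: t ↦ s(t), t ∈ ℤ_N.
Seq : (m N : ℕ) → Set
Seq m N = Fin N → Fin m

_⊕_ : {N : ℕ} .{{_ : NonZero N}} → Fin N → ℕ → Fin N
_⊕_ {N} t τ = (toℕ t ℕ.+ τ) mod N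

shiftL : {m N : ℕ} .{{_ : NonZero N}} → ℕ → Seq m N → Seq m N
shiftL τ s t = s (t ⊕ τ)

complement : {N : ℕ} → Seq 2 N → Seq 2 N
complement s t with s t
... | zero = suc zero
... | suc _ = zero

-- Gaussian integers ℤ[i], as pairs (real part, imaginary part)
GI : Set
GI = ℤ × ℤ

_+G_ : GI → GI → GI
(a , b) +G (c , d) = (a ℤ.+ c , b ℤ.+ d)

0G : GI
0G = (0ℤ , 0ℤ)

negOnePow : ℕ → ℤ
negOnePow k with k % 2
... | zero = 1ℤ
... | suc _ = - 1ℤ

iPow : ℕ → GI
iPow k with k % 4
... | 0 = (1ℤ , 0ℤ)
... | 1 = (0ℤ , 1ℤ)
... | 2 = (- 1ℤ , 0ℤ)
... | _ = (0ℤ , - 1ℤ)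

sumℤ : (N : ℕ) → (Fin N → ℤ) → ℤ
sumℤ N f = foldr ℤ._+_ 0ℤ (map f (allFin N))

sumG : (N : ℕ) → (Fin N → GI) → GI
sumG N f = foldr _+G_ 0G (map f (allFin N))

-- difference a - b in ℤ_m, as a natural number representative (a + (m - b))
diffRep : {m : ℕ} → Fin m → Fin m → ℕ
diffRep {m} a b = toℕ a ℕ.+ (m ∸ toℕ b)

R₂ : {N : ℕ} .{{_ : NonZero N}} → Seq 2 N → ℕ → ℤ
R₂ {N} s τ = sumℤ N (λ t → negOnePow (diffRep (s t) (s (t ⊕ τ))))

R₄ : {N : ℕ} .{{_ : NonZero N}} → Seq 4 N → ℕ → GI
R₄ {N} u τ = sumG N (λ t → iPow (diffRep (u t) (u (t ⊕ τ))))

count : {m N : ℕ} → Seq m N → Fin m → ℕ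
count {m} {N} s k = Data.Fin.Subset.∣_∣ {N} (tabulate (λ t → does (s t ≟ k)))

supp : {N : ℕ} → Seq 2 N → Subset N
supp s = tabulate (λ t → does (s t ≟ suc zero))

φ⁻¹ : Fin 2 → Fin 2 → Fin 4
φ⁻¹ zero zero = zero
φ⁻¹ zero (suc zero) = suc zero
φ⁻¹ (suc zero) (suc zero) = suc (suc zero)
φ⁻¹ (suc zero) zero = suc (suc (suc zero))

grayCombine : {N : ℕ} → Seq 2 N → Seq 2 N → Seq 4 N
grayCombine s₀ s₁ t = φ⁻¹ (s₀ t) (s₁ t)

module Submission where

-- Write χ(x , y) = (-1)^(x - y) and C(x , y)(τ) = Σ_t χ(x(t) , y(t + τ)) for the
-- periodic cross-correlation of binary sequences, so that R_s = C(s , s).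
-- A sixteen-case truth table for the Gray map gives, for every pair s₀ , s₁,
--   2 Re R_u(τ) = C(s₀ , s₀)(τ) + C(s₁ , s₁)(τ),
--   2 Im R_u(τ) = C(s₀ , s₁)(τ) - C(s₁ , s₀)(τ),      u = φ⁻¹(s₀ , s₁).
-- If s₁(t) = g(s₀(t + N/2)) with g the identity or the complement, the
-- substitution t ↦ t + N/2, an involution of ℤ_N, shows C(s₁ , s₁) = C(s₀ , s₀)
-- and C(s₀ , s₁) = C(s₁ , s₀); hence R_u = R_{s₀}.  The counting statements
-- hold for arbitrary s₀ , s₁: since φ⁻¹ is a bijection, the level set
-- {t : u(t) = φ⁻¹(a , b)} is the intersection of the level sets of s₀ at a and
-- of s₁ at b, and the level set of a binary sequence at 0 is ∁ of its support.

open import Defs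
import Algebra.Properties.CommutativeMonoid.Sum as CommutativeMonoidSum
open import Data.Bool using (Bool; not; _∧_)
open import Data.Fin as F using (Fin; toℕ; zero; suc)
open import Data.Fin.Permutation using (permutation)
open import Data.Fin.Properties using (toℕ-fromℕ<; toℕ-injective; toℕ<n)
open import Data.Fin.Subset using (Subset; ∣_∣; _∩_; ∁)
open import Data.Integer as ℤ using (ℤ; 0ℤ; _+_; _-_; _*_; -_)
import Data.Integer.Properties as ℤP
open import Data.List as L using (List; []; _∷_)
open import Data.List.Properties using (map-tabulate)
open import Data.Nat as ℕ using (ℕ; NonZero; _/_; _%_)
open import Data.Nat.Divisibility using (_∣_)
open import Data.Nat.DivMod using (%-distribˡ-+; m%n%n≡m%n; [m+n]%n≡m%n; m<n⇒m%n≡m; m*[n/m]≡n)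
import Data.Nat.Properties as ℕP
open import Data.Product using (_×_; _,_; proj₁; proj₂)
open import Data.Sum using (_⊎_; inj₁; inj₂)
open import Data.Vec as V using (tabulate)
open import Data.Vec.Properties using (tabulate-∘; tabulate-cong)
open import Function using (_∘_; id)
open import Relation.Nullary using (does)
open import Relation.Binary.PropositionalEquality
  using (_≡_; refl; sym; trans; cong; cong₂; module ≡-Reasoning)
open ≡-Reasoning

open CommutativeMonoidSum ℤP.+-0-commutativeMonoid
  using (sum; sum-cong-≗; ∑-distrib-+; sum-permute)

foldr-tabulate : ∀ n (f : Fin n → ℤ) → L.foldr _+_ 0ℤ (L.tabulate f) ≡ sum f
foldr-tabulate ℕ.zero f = refl
foldr-tabulate (ℕ.suc n) f = cong (f zero +_) (foldr-tabulate n (f ∘ suc))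

sumℤ≡sum : ∀ N (f : Fin N → ℤ) → sumℤ N f ≡ sum f
sumℤ≡sum N f = trans (cong (L.foldr _+_ 0ℤ) (map-tabulate id f)) (foldr-tabulate N f)

foldr-+G : ∀ {A : Set} (f : A → GI) (xs : List A) →
  L.foldr _+G_ 0G (L.map f xs) ≡
  (L.foldr _+_ 0ℤ (L.map (proj₁ ∘ f) xs) , L.foldr _+_ 0ℤ (L.map (proj₂ ∘ f) xs))
foldr-+G f [] = refl
foldr-+G f (x ∷ xs) rewrite foldr-+G f xs = refl

sumG≡sums : ∀ N (f : Fin N → GI) → sumG N f ≡ (sum (proj₁ ∘ f) , sum (proj₂ ∘ f))
sumG≡sums N f = trans (foldr-+G f (L.allFin N)) (cong₂ _,_ (sumℤ≡sum N _) (sumℤ≡sum N _))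

sum-neg : ∀ {n} (f : Fin n → ℤ) → sum (λ t → - f t) ≡ - sum f
sum-neg {ℕ.zero} f = refl
sum-neg {ℕ.suc n} f = begin
  - f zero + sum (λ t → - f (suc t)) ≡⟨ cong (- f zero +_) (sum-neg (f ∘ suc)) ⟩
  - f zero + - sum (f ∘ suc)         ≡⟨ ℤP.neg-distrib-+ (f zero) (sum (f ∘ suc)) ⟨
  - (f zero + sum (f ∘ suc))         ∎

sum-involution : ∀ {n} (σ : Fin n → Fin n) → (∀ t → σ (σ t) ≡ t) →
  (f : Fin n → ℤ) → sum f ≡ sum (f ∘ σ)
sum-involution σ σσ f = sum-permute f (permutation σ σ σσ σσ)

-- Doubling is injective on ℤ; the correlation identities determine 2 R_u.
double-injective : ∀ x y → x + x ≡ y + y → x ≡ y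
double-injective x y e = ℤP.*-cancelˡ-≡ (ℤ.+ 2) x y (begin
  ℤ.+ 2 * x ≡⟨ twice x ⟩
  x + x     ≡⟨ e ⟩
  y + y     ≡⟨ twice y ⟨
  ℤ.+ 2 * y ∎)
  where
  twice : ∀ z → ℤ.+ 2 * z ≡ z + z
  twice z = trans (ℤP.*-distribʳ-+ z (ℤ.+ 1) (ℤ.+ 1))
                  (cong₂ _+_ (ℤP.*-identityˡ z) (ℤP.*-identityˡ z))

module Shifts (N : ℕ) .{{_ : NonZero N}} where

  toℕ-⊕ : (t : Fin N) (x : ℕ) → toℕ (t ⊕ x) ≡ (toℕ t ℕ.+ x) % N
  toℕ-⊕ t x = toℕ-fromℕ< _

  toℕ-⊕⊕ : (t : Fin N) (x y : ℕ) → toℕ ((t ⊕ x) ⊕ y) ≡ (toℕ t ℕ.+ x ℕ.+ y) % N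
  toℕ-⊕⊕ t x y = begin
    toℕ ((t ⊕ x) ⊕ y)                   ≡⟨ toℕ-⊕ (t ⊕ x) y ⟩
    (toℕ (t ⊕ x) ℕ.+ y) % N             ≡⟨ cong (λ z → (z ℕ.+ y) % N) (toℕ-⊕ t x) ⟩
    (m % N ℕ.+ y) % N                   ≡⟨ %-distribˡ-+ (m % N) y N ⟩
    (m % N % N ℕ.+ y % N) % N           ≡⟨ cong (λ z → (z ℕ.+ y % N) % N) (m%n%n≡m%n m N) ⟩
    (m % N ℕ.+ y % N) % N               ≡⟨ %-distribˡ-+ m y N ⟨
    (m ℕ.+ y) % N                       ∎
    where
    m : ℕ
    m = toℕ t ℕ.+ x

  ⊕-swap : (t : Fin N) (x y : ℕ) → (t ⊕ x) ⊕ y ≡ (t ⊕ y) ⊕ x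
  ⊕-swap t x y = toℕ-injective (begin
    toℕ ((t ⊕ x) ⊕ y)          ≡⟨ toℕ-⊕⊕ t x y ⟩
    (toℕ t ℕ.+ x ℕ.+ y) % N    ≡⟨ cong (_% N) (ℕP.+-assoc (toℕ t) x y) ⟩
    (toℕ t ℕ.+ (x ℕ.+ y)) % N  ≡⟨ cong (λ z → (toℕ t ℕ.+ z) % N) (ℕP.+-comm x y) ⟩
    (toℕ t ℕ.+ (y ℕ.+ x)) % N  ≡⟨ cong (_% N) (ℕP.+-assoc (toℕ t) y x) ⟨
    (toℕ t ℕ.+ y ℕ.+ x) % N    ≡⟨ toℕ-⊕⊕ t y x ⟨
    toℕ ((t ⊕ y) ⊕ x)          ∎)

  half-shift-involutive : (M : ℕ) → M ℕ.+ M ≡ N → (t : Fin N) → (t ⊕ M) ⊕ M ≡ t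
  half-shift-involutive M M+M≡N t = toℕ-injective (begin
    toℕ ((t ⊕ M) ⊕ M)         ≡⟨ toℕ-⊕⊕ t M M ⟩
    (toℕ t ℕ.+ M ℕ.+ M) % N   ≡⟨ cong (_% N) (ℕP.+-assoc (toℕ t) M M) ⟩
    (toℕ t ℕ.+ (M ℕ.+ M)) % N ≡⟨ cong (λ z → (toℕ t ℕ.+ z) % N) M+M≡N ⟩
    (toℕ t ℕ.+ N) % N         ≡⟨ [m+n]%n≡m%n (toℕ t) N ⟩
    toℕ t % N                 ≡⟨ m<n⇒m%n≡m (toℕ<n t) ⟩
    toℕ t                     ∎)

half-of-even : ∀ N → 2 ∣ N → N / 2 ℕ.+ N / 2 ≡ N
half-of-even N 2∣N = trans (cong (N / 2 ℕ.+_) (sym (ℕP.+-identityʳ (N / 2)))) (m*[n/m]≡n 2∣N)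

χ : Fin 2 → Fin 2 → ℤ
χ x y = negOnePow (diffRep x y)

grayTerm : Fin 2 → Fin 2 → Fin 2 → Fin 2 → GI
grayTerm a b a' b' = iPow (diffRep (φ⁻¹ a b) (φ⁻¹ a' b'))

gray-re : ∀ a b a' b' → proj₁ (grayTerm a b a' b') + proj₁ (grayTerm a b a' b') ≡ χ a a' + χ b b'
gray-re zero       zero       zero       zero       = refl
gray-re zero       zero       zero       (suc zero) = refl
gray-re zero       zero       (suc zero) zero       = refl
gray-re zero       zero       (suc zero) (suc zero) = refl
gray-re zero       (suc zero) zero       zero       = refl
gray-re zero       (suc zero) zero       (suc zero) = refl
gray-re zero       (suc zero) (suc zero) zero       = refl
gray-re zero       (suc zero) (suc zero) (suc zero) = refl
gray-re (suc zero) zero       zero       zero       = refl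
gray-re (suc zero) zero       zero       (suc zero) = refl
gray-re (suc zero) zero       (suc zero) zero       = refl
gray-re (suc zero) zero       (suc zero) (suc zero) = refl
gray-re (suc zero) (suc zero) zero       zero       = refl
gray-re (suc zero) (suc zero) zero       (suc zero) = refl
gray-re (suc zero) (suc zero) (suc zero) zero       = refl
gray-re (suc zero) (suc zero) (suc zero) (suc zero) = refl

gray-im : ∀ a b a' b' → proj₂ (grayTerm a b a' b') + proj₂ (grayTerm a b a' b') ≡ χ a b' - χ b a'
gray-im zero       zero       zero       zero       = refl
gray-im zero       zero       zero       (suc zero) = refl
gray-im zero       zero       (suc zero) zero       = refl
gray-im zero       zero       (suc zero) (suc zero) = refl
gray-im zero       (suc zero) zero       zero       = refl
gray-im zero       (suc zero) zero       (suc zero) = refl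
gray-im zero       (suc zero) (suc zero) zero       = refl
gray-im zero       (suc zero) (suc zero) (suc zero) = refl
gray-im (suc zero) zero       zero       zero       = refl
gray-im (suc zero) zero       zero       (suc zero) = refl
gray-im (suc zero) zero       (suc zero) zero       = refl
gray-im (suc zero) zero       (suc zero) (suc zero) = refl
gray-im (suc zero) (suc zero) zero       zero       = refl
gray-im (suc zero) (suc zero) zero       (suc zero) = refl
gray-im (suc zero) (suc zero) (suc zero) zero       = refl
gray-im (suc zero) (suc zero) (suc zero) (suc zero) = refl

record SignCompatible (g : Fin 2 → Fin 2) : Set where
  field
    χ-invariant : ∀ x y → χ (g x) (g y) ≡ χ x y
    χ-transfer  : ∀ x y → χ x (g y) ≡ χ (g x) y

id-compatible : SignCompatible id
id-compatible = record { χ-invariant = λ x y → refl ; χ-transfer = λ x y → refl }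

flip : Fin 2 → Fin 2
flip zero = suc zero
flip (suc _) = zero

complement≡flip : ∀ {N} (s : Seq 2 N) t → complement s t ≡ flip (s t)
complement≡flip s t with s t
... | zero     = refl
... | suc zero = refl

flip-compatible : SignCompatible flip
flip-compatible = record { χ-invariant = invariant ; χ-transfer = transfer }
  where
  invariant : ∀ x y → χ (flip x) (flip y) ≡ χ x y
  invariant zero       zero       = refl
  invariant zero       (suc zero) = refl
  invariant (suc zero) zero       = refl
  invariant (suc zero) (suc zero) = refl
  transfer : ∀ x y → χ x (flip y) ≡ χ (flip x) y
  transfer zero       zero       = refl
  transfer zero       (suc zero) = refl
  transfer (suc zero) zero       = refl
  transfer (suc zero) (suc zero) = refl

module Correlation (N : ℕ) .{{_ : NonZero N}} where

  open Shifts N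

  crossCorr : Seq 2 N → Seq 2 N → ℕ → ℤ
  crossCorr x y τ = sum (λ t → χ (x t) (y (t ⊕ τ)))

  R₂≡crossCorr : (s : Seq 2 N) (τ : ℕ) → R₂ s τ ≡ crossCorr s s τ
  R₂≡crossCorr s τ = sumℤ≡sum N _

  module _ (s₀ s₁ : Seq 2 N) (τ : ℕ) where

    grayTerms : Fin N → GI
    grayTerms t = grayTerm (s₀ t) (s₁ t) (s₀ (t ⊕ τ)) (s₁ (t ⊕ τ))

    realParts imagParts : Fin N → ℤ
    realParts = proj₁ ∘ grayTerms
    imagParts = proj₂ ∘ grayTerms

    R₄≡parts : R₄ (grayCombine s₀ s₁) τ ≡ (sum realParts , sum imagParts)
    R₄≡parts = sumG≡sums N grayTerms

    gray-re-sum : sum realParts + sum realParts ≡ crossCorr s₀ s₀ τ + crossCorr s₁ s₁ τ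
    gray-re-sum = begin
      sum realParts + sum realParts
        ≡⟨ ∑-distrib-+ realParts realParts ⟨
      sum (λ t → realParts t + realParts t)
        ≡⟨ sum-cong-≗ (λ t → gray-re (s₀ t) (s₁ t) (s₀ (t ⊕ τ)) (s₁ (t ⊕ τ))) ⟩
      sum (λ t → χ (s₀ t) (s₀ (t ⊕ τ)) + χ (s₁ t) (s₁ (t ⊕ τ)))
        ≡⟨ ∑-distrib-+ (λ t → χ (s₀ t) (s₀ (t ⊕ τ))) (λ t → χ (s₁ t) (s₁ (t ⊕ τ))) ⟩
      crossCorr s₀ s₀ τ + crossCorr s₁ s₁ τ
        ∎

    gray-im-sum : sum imagParts + sum imagParts ≡ crossCorr s₀ s₁ τ - crossCorr s₁ s₀ τ
    gray-im-sum = begin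
      sum imagParts + sum imagParts
        ≡⟨ ∑-distrib-+ imagParts imagParts ⟨
      sum (λ t → imagParts t + imagParts t)
        ≡⟨ sum-cong-≗ (λ t → gray-im (s₀ t) (s₁ t) (s₀ (t ⊕ τ)) (s₁ (t ⊕ τ))) ⟩
      sum (λ t → χ (s₀ t) (s₁ (t ⊕ τ)) + - χ (s₁ t) (s₀ (t ⊕ τ)))
        ≡⟨ ∑-distrib-+ (λ t → χ (s₀ t) (s₁ (t ⊕ τ))) (λ t → - χ (s₁ t) (s₀ (t ⊕ τ))) ⟩
      crossCorr s₀ s₁ τ + sum (λ t → - χ (s₁ t) (s₀ (t ⊕ τ)))
        ≡⟨ cong (crossCorr s₀ s₁ τ +_) (sum-neg (λ t → χ (s₁ t) (s₀ (t ⊕ τ)))) ⟩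
      crossCorr s₀ s₁ τ - crossCorr s₁ s₀ τ
        ∎

  module HalfShift (M : ℕ) (M+M≡N : M ℕ.+ M ≡ N) (s₀ s₁ : Seq 2 N)
    (g : Fin 2 → Fin 2) (compatible : SignCompatible g)
    (s₁≡ : ∀ t → s₁ t ≡ g (s₀ (t ⊕ M))) where

    open SignCompatible compatible

    σ : Fin N → Fin N
    σ t = t ⊕ M

    σ-involutive : ∀ t → σ (σ t) ≡ t
    σ-involutive = half-shift-involutive M M+M≡N

    autocorr-equal : ∀ τ → crossCorr s₁ s₁ τ ≡ crossCorr s₀ s₀ τ
    autocorr-equal τ = trans (sum-cong-≗ shifted) (sym (sum-involution σ σ-involutive _))
      where
      shifted : ∀ t → χ (s₁ t) (s₁ (t ⊕ τ)) ≡ χ (s₀ (σ t)) (s₀ (σ t ⊕ τ))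
      shifted t = begin
        χ (s₁ t) (s₁ (t ⊕ τ))                   ≡⟨ cong₂ χ (s₁≡ t) (s₁≡ (t ⊕ τ)) ⟩
        χ (g (s₀ (σ t))) (g (s₀ ((t ⊕ τ) ⊕ M))) ≡⟨ χ-invariant _ _ ⟩
        χ (s₀ (σ t)) (s₀ ((t ⊕ τ) ⊕ M))         ≡⟨ cong (χ (s₀ (σ t)) ∘ s₀) (⊕-swap t τ M) ⟩
        χ (s₀ (σ t)) (s₀ (σ t ⊕ τ))             ∎

    crossCorr-symmetric : ∀ τ → crossCorr s₀ s₁ τ ≡ crossCorr s₁ s₀ τ
    crossCorr-symmetric τ = begin
      crossCorr s₀ s₁ τ                       ≡⟨ sum-cong-≗ forward ⟩
      sum common                              ≡⟨ sum-cong-≗ backward ⟨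
      sum (λ t → χ (s₁ (σ t)) (s₀ (σ t ⊕ τ))) ≡⟨ sum-involution σ σ-involutive _ ⟨
      crossCorr s₁ s₀ τ                       ∎
      where
      common : Fin N → ℤ
      common t = χ (g (s₀ t)) (s₀ (σ (t ⊕ τ)))
      forward : ∀ t → χ (s₀ t) (s₁ (t ⊕ τ)) ≡ common t
      forward t = trans (cong (χ (s₀ t)) (s₁≡ (t ⊕ τ))) (χ-transfer _ _)
      backward : ∀ t → χ (s₁ (σ t)) (s₀ (σ t ⊕ τ)) ≡ common t
      backward t = begin
        χ (s₁ (σ t)) (s₀ (σ t ⊕ τ))         ≡⟨ cong (λ z → χ z (s₀ (σ t ⊕ τ))) (s₁≡ (σ t)) ⟩
        χ (g (s₀ (σ (σ t)))) (s₀ (σ t ⊕ τ)) ≡⟨ cong₂ (λ z w → χ (g (s₀ z)) (s₀ w)) (σ-involutive t) (⊕-swap t M τ) ⟩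
        common t                            ∎

    gray-autocorrelation : ∀ τ → R₄ (grayCombine s₀ s₁) τ ≡ (R₂ s₀ τ , 0ℤ)
    gray-autocorrelation τ = trans (R₄≡parts s₀ s₁ τ) (cong₂ _,_ real imaginary)
      where
      real : sum (realParts s₀ s₁ τ) ≡ R₂ s₀ τ
      real = double-injective _ _ (begin
        sum (realParts s₀ s₁ τ) + sum (realParts s₀ s₁ τ)
          ≡⟨ gray-re-sum s₀ s₁ τ ⟩
        crossCorr s₀ s₀ τ + crossCorr s₁ s₁ τ
          ≡⟨ cong (crossCorr s₀ s₀ τ +_) (autocorr-equal τ) ⟩
        crossCorr s₀ s₀ τ + crossCorr s₀ s₀ τ
          ≡⟨ cong₂ _+_ (R₂≡crossCorr s₀ τ) (R₂≡crossCorr s₀ τ) ⟨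
        R₂ s₀ τ + R₂ s₀ τ
          ∎)
      imaginary : sum (imagParts s₀ s₁ τ) ≡ 0ℤ
      imaginary = double-injective _ _ (begin
        sum (imagParts s₀ s₁ τ) + sum (imagParts s₀ s₁ τ)
          ≡⟨ gray-im-sum s₀ s₁ τ ⟩
        crossCorr s₀ s₁ τ - crossCorr s₁ s₀ τ
          ≡⟨ cong (_- crossCorr s₁ s₀ τ) (crossCorr-symmetric τ) ⟩
        crossCorr s₁ s₀ τ - crossCorr s₁ s₀ τ
          ≡⟨ ℤP.+-inverseʳ (crossCorr s₁ s₀ τ) ⟩
        0ℤ + 0ℤ
          ∎)

levelSet : {m N : ℕ} → Seq m N → Fin m → Subset N
levelSet s k = tabulate (λ t → does (s t F.≟ k))

tabulate-∩ : ∀ {n} (f g : Fin n → Bool) → tabulate (λ t → f t ∧ g t) ≡ tabulate f ∩ tabulate g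
tabulate-∩ {ℕ.zero} f g = refl
tabulate-∩ {ℕ.suc n} f g = cong (f zero ∧ g zero V.∷_) (tabulate-∩ (f ∘ suc) (g ∘ suc))

gray-indicator : ∀ x y a b → does (φ⁻¹ x y F.≟ φ⁻¹ a b) ≡ does (x F.≟ a) ∧ does (y F.≟ b)
gray-indicator zero       zero       zero       zero       = refl
gray-indicator zero       zero       zero       (suc zero) = refl
gray-indicator zero       zero       (suc zero) zero       = refl
gray-indicator zero       zero       (suc zero) (suc zero) = refl
gray-indicator zero       (suc zero) zero       zero       = refl
gray-indicator zero       (suc zero) zero       (suc zero) = refl
gray-indicator zero       (suc zero) (suc zero) zero       = refl
gray-indicator zero       (suc zero) (suc zero) (suc zero) = refl
gray-indicator (suc zero) zero       zero       zero       = refl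
gray-indicator (suc zero) zero       zero       (suc zero) = refl
gray-indicator (suc zero) zero       (suc zero) zero       = refl
gray-indicator (suc zero) zero       (suc zero) (suc zero) = refl
gray-indicator (suc zero) (suc zero) zero       zero       = refl
gray-indicator (suc zero) (suc zero) zero       (suc zero) = refl
gray-indicator (suc zero) (suc zero) (suc zero) zero       = refl
gray-indicator (suc zero) (suc zero) (suc zero) (suc zero) = refl

count-gray : ∀ {N} (s₀ s₁ : Seq 2 N) a b →
  count (grayCombine s₀ s₁) (φ⁻¹ a b) ≡ ∣ levelSet s₀ a ∩ levelSet s₁ b ∣
count-gray s₀ s₁ a b = cong ∣_∣ (trans (tabulate-cong (λ t → gray-indicator (s₀ t) (s₁ t) a b))
                                       (tabulate-∩ _ _))

levelSet-zero : ∀ {N} (s : Seq 2 N) → levelSet s zero ≡ ∁ (supp s)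
levelSet-zero s = trans (tabulate-cong (isZero ∘ s)) (tabulate-∘ not _)
  where
  isZero : (x : Fin 2) → does (x F.≟ zero) ≡ not (does (x F.≟ suc zero))
  isZero zero       = refl
  isZero (suc zero) = refl

theorem3 : (N : ℕ) .{{_ : NonZero N}} → 2 ∣ N →
    (s₀ s₁ : Seq 2 N) →
    ((∀ t → s₁ t ≡ shiftL (N / 2) s₀ t) ⊎ (∀ t → s₁ t ≡ shiftL (N / 2) (complement s₀) t)) →
    ((τ : Fin N) → R₄ (grayCombine s₀ s₁) (toℕ τ) ≡ (R₂ s₀ (toℕ τ) , 0ℤ))
    × count (grayCombine s₀ s₁) zero ≡ ∣ ∁ (supp s₀) ∩ ∁ (supp s₁) ∣
    × count (grayCombine s₀ s₁) (suc zero) ≡ ∣ ∁ (supp s₀) ∩ supp s₁ ∣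
    × count (grayCombine s₀ s₁) (suc (suc zero)) ≡ ∣ supp s₀ ∩ supp s₁ ∣
    × count (grayCombine s₀ s₁) (suc (suc (suc zero))) ≡ ∣ supp s₀ ∩ ∁ (supp s₁) ∣
theorem3 N 2∣N s₀ s₁ shifted = correlation shifted , N₀ , N₁ , N₂ , N₃
  where
  open Correlation N using (module HalfShift)

  M+M≡N : N / 2 ℕ.+ N / 2 ≡ N
  M+M≡N = half-of-even N 2∣N

  correlation : (∀ t → s₁ t ≡ shiftL (N / 2) s₀ t) ⊎ (∀ t → s₁ t ≡ shiftL (N / 2) (complement s₀) t) →
                (τ : Fin N) → R₄ (grayCombine s₀ s₁) (toℕ τ) ≡ (R₂ s₀ (toℕ τ) , 0ℤ)
  correlation (inj₁ s₁≡) τ =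
    HalfShift.gray-autocorrelation (N / 2) M+M≡N s₀ s₁ id id-compatible s₁≡ (toℕ τ)
  correlation (inj₂ s₁≡) τ =
    HalfShift.gray-autocorrelation (N / 2) M+M≡N s₀ s₁ flip flip-compatible
      (λ t → trans (s₁≡ t) (complement≡flip s₀ (t ⊕ (N / 2)))) (toℕ τ)

  N₀ : count (grayCombine s₀ s₁) zero ≡ ∣ ∁ (supp s₀) ∩ ∁ (supp s₁) ∣
  N₀ = trans (count-gray s₀ s₁ zero zero)
             (cong ∣_∣ (cong₂ _∩_ (levelSet-zero s₀) (levelSet-zero s₁)))

  N₁ : count (grayCombine s₀ s₁) (suc zero) ≡ ∣ ∁ (supp s₀) ∩ supp s₁ ∣
  N₁ = trans (count-gray s₀ s₁ zero (suc zero)) (cong (λ A → ∣ A ∩ supp s₁ ∣) (levelSet-zero s₀))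

  N₂ : count (grayCombine s₀ s₁) (suc (suc zero)) ≡ ∣ supp s₀ ∩ supp s₁ ∣
  N₂ = count-gray s₀ s₁ (suc zero) (suc zero)

  N₃ : count (grayCombine s₀ s₁) (suc (suc (suc zero))) ≡ ∣ supp s₀ ∩ ∁ (supp s₁) ∣
  N₃ = trans (count-gray s₀ s₁ (suc zero) zero) (cong (λ B → ∣ supp s₀ ∩ B ∣) (levelSet-zero s₁))
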